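{- Let $t$ be a tour of length at most $D$. Let $c_1,\dots,c_k$ be the components containing terminals visited by $t$, and for each $i\in[1,k]$ let $s_i$ be the subtour of $t$ in $c_i$. Then $\sum_{i=1}^k\bar\ell(s_i)\le1$.
   Context: Setting: a rooted tree $T=(V,E)$ with non-negative integer edge weights, root (depot) $r$, a set $U$ of terminals, and a positive integer distance constraint $D$. A tour is a closed walk starting and ending at $r$, traversing each of its edges exactly twice (once in each direction); its length is the sum of the weights of traversed edges. $\mathrm{dist}(u,v)$ is the tree distance. The edges of $T$ are partitioned into a set $\mathcal C$ of components such that: each component $c$ is a connected subgraph of $T$, with root $r_c$ its vertex closest to $r$; a component $c$ is a leaf component if all descendants of $r_c$ are in $c$, and internal otherwise; an internal component shares vertices with other components only at $r_c$ and at one other vertex $e_c$, its exit vertex. It is assumed that $D-2\mathrm{dist}(r,r_c)>0$ and, for internal $c$, $D-2\mathrm{dist}(r,e_c)>0$ whenever these appear as denominators. A subtour in component $c$ is a walk inside $c$ starting and ending at $r_c$ that visits at least one terminal; the subtour of a tour $t$ in $c$ is the restriction of $t$ to the edges of $c$. A subtour $s$ in $c$ is passing if $c$ is internal and $e_c$ lies on $s$, and ending otherwise. Its reduced length is $\bar\ell(s)=\frac{\mathrm{length}(s)}{D-2\mathrm{dist}(r,r_c)}$ if $s$ is ending, and $\bar\ell(s)=\frac{\mathrm{length}(s)-2\mathrm{dist}(r_c,e_c)}{D-2\mathrm{dist}(r,e_c)}$ if $s$ is passing. -}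

module Defs where

open import Data.Nat as ℕ using (ℕ; zero; suc; _+_; _*_; _∸_; _≤_; _<_; _<ᵇ_)
open import Data.Fin using (Fin; zero; suc; toℕ; _≟_)
open import Data.List using (List; []; _∷_; map; allFin; foldr; last)
open import Data.Nat.ListAction using (sum)
open import Data.Bool.ListAction using (any)
open import Data.List.Relation.Unary.All using (All)
open import Data.List.Membership.Propositional using (_∈_)
open import Data.Bool using (Bool; true; false; _∧_; _∨_; if_then_else_)
open import Data.Maybe using (Maybe; just; nothing)
open import Data.Product using (Σ; ∃; _×_; _,_; proj₁; proj₂)
open import Data.Sum using (_⊎_)
open import Relation.Binary.PropositionalEquality using (_≡_)
open import Relation.Nullary using (¬_; does)
open import Data.Integer as ℤ using (ℤ; +_)
open import Data.Rational as ℚ using (ℚ; 0ℚ)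

-- Vertices are Fin (suc n), the root (depot) r is vertex zero.
-- There are n edges, indexed by Fin n: edge i joins the vertex (suc i)
-- to its parent (parent i), whose label is strictly smaller.  Every
-- rooted tree admits such a labelling.  w i is the (non-negative
-- integer) weight of edge i.

record Tree : Set where
  field
    n        : ℕ
    parent   : Fin n → Fin (suc n)
    parent-< : ∀ i → toℕ (parent i) ≤ toℕ i
    w        : Fin n → ℕ

module _ (T : Tree) where
  open Tree T

  Vertex : Set
  Vertex = Fin (suc n)

  root : Vertex
  root = zero

  -- weighted depth with fuel (fuel toℕ v suffices since labels decrease)
  depthF : ℕ → Vertex → ℕ
  depthF zero    _       = 0
  depthF (suc k) zero    = 0
  depthF (suc k) (suc i) = w i + depthF k (parent i)

  depth : Vertex → ℕ
  depth v = depthF (toℕ v) v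

  data _≼_ (u : Vertex) : Vertex → Set where
    ≼-refl : u ≼ u
    ≼-step : ∀ {i} → u ≼ parent i → u ≼ suc i

  Adjacent : Vertex → Vertex → Set
  Adjacent u v = ∃ λ e → (u ≡ suc e × v ≡ parent e) ⊎ (u ≡ parent e × v ≡ suc e)

  steps : List Vertex → List (Vertex × Vertex)
  steps (x ∷ y ∷ r) = (x , y) ∷ steps (y ∷ r)
  steps _           = []

  count : Vertex → Vertex → List (Vertex × Vertex) → ℕ
  count a b []            = 0
  count a b ((x , y) ∷ r) = (if does (x ≟ a) ∧ does (y ≟ b) then 1 else 0) + count a b r

  upCount downCount trav : Fin n → List Vertex → ℕ
  upCount   e ws = count (suc e) (parent e) (steps ws)
  downCount e ws = count (parent e) (suc e) (steps ws)
  trav      e ws = upCount e ws + downCount e ws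

  record Tour : Set where
    field
      walk     : List Vertex
      starts   : ∃ λ xs → walk ≡ root ∷ xs
      ends     : last walk ≡ just root
      adjacent : All (λ p → Adjacent (proj₁ p) (proj₂ p)) (steps walk)
      twice    : ∀ e → (upCount e walk ≡ 0 × downCount e walk ≡ 0)
                     ⊎ (upCount e walk ≡ 1 × downCount e walk ≡ 1)
  open Tour public

  tourLength : Tour → ℕ
  tourLength t = sum (map (λ e → w e * trav e (walk t)) (allFin n))

  Visits : Tour → Vertex → Set
  Visits t v = v ∈ walk t

  module _ {m : ℕ} (comp : Fin n → Fin m) where

    InV : Fin m → Vertex → Set
    InV c v = ∃ λ e → comp e ≡ c × (v ≡ suc e ⊎ v ≡ parent e)

    data PathIn (c : Fin m) : Vertex → Vertex → Set where
      here  : ∀ {u} → PathIn c u u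
      there : ∀ {u x v} e → comp e ≡ c
            → (u ≡ suc e × x ≡ parent e) ⊎ (u ≡ parent e × x ≡ suc e)
            → PathIn c x v → PathIn c u v

    Leaf : Fin m → Vertex → Set
    Leaf c rc = ∀ v → rc ≼ v → InV c v

    data ExitSpec (c : Fin m) (rc : Vertex) : Maybe Vertex → Set where
      leaf     : Leaf c rc → ExitSpec c rc nothing
      internal : ∀ x → ¬ Leaf c rc → InV c x → ¬ (x ≡ rc)
               → (∃ λ c' → ¬ (c' ≡ c) × InV c' x)
               → (∀ c' v → ¬ (c' ≡ c) → InV c v → InV c' v → v ≡ rc ⊎ v ≡ x)
               → ExitSpec c rc (just x)

  record Partition : Set where
    field
      m         : ℕ
      comp      : Fin n → Fin m
      rt        : Fin m → Vertex
      ex        : Fin m → Maybe Vertex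
      nonempty  : ∀ c → ∃ λ e → comp e ≡ c
      connected : ∀ c u v → InV comp c u → InV comp c v → PathIn comp c u v
      rt-in     : ∀ c → InV comp c (rt c)
      rt-top    : ∀ c v → InV comp c v → rt c ≼ v
      ex-spec   : ∀ c → ExitSpec comp c (rt c) (ex c)

  module _ (P : Partition) where
    open Partition P

    VisitedComp : (Vertex → Set) → Tour → Fin m → Set
    VisitedComp U t c = ∃ λ u → U u × InV comp c u × Visits t u

    subLength : Tour → Fin m → ℕ
    subLength t c = sum (map (λ e → if does (comp e ≟ c) then w e * trav e (walk t) else 0) (allFin n))

    onSub : Tour → Fin m → Vertex → Bool
    onSub t c x = does (x ≟ rt c) ∨
      any (λ e → does (comp e ≟ c) ∧ (0 <ᵇ trav e (walk t)) ∧ (does (x ≟ suc e) ∨ does (x ≟ parent e))) (allFin n)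

    -- p / q as a rational (q > 0 is guaranteed by hypotheses where used)
    frac : ℤ → ℕ → ℚ
    frac p zero    = 0ℚ
    frac p (suc q) = p ℚ./ suc q

    endingRL : ℕ → Tour → Fin m → ℚ
    endingRL D t c = frac (+ subLength t c) (D ∸ 2 * depth (rt c))

    passingRL : ℕ → Tour → Fin m → Vertex → ℚ
    passingRL D t c x = frac (+ subLength t c ℤ.- + (2 * (depth x ∸ depth (rt c)))) (D ∸ 2 * depth x)

    reducedLength : ℕ → Tour → Fin m → ℚ
    reducedLength D t c with ex c
    ... | nothing = endingRL D t c
    ... | just x  = if onSub t c x then passingRL D t c x else endingRL D t c

    DenomPos : ℕ → Tour → Fin m → Set
    DenomPos D t c with ex c
    ... | nothing = 2 * depth (rt c) < D
    ... | just x  = if onSub t c x then 2 * depth x < D else 2 * depth (rt c) < D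

sumℚ : List ℚ → ℚ
sumℚ = foldr ℚ._+_ 0ℚ

{-# OPTIONS --safe #-}
-- For a vertex v let L(v) be the length of t inside the components whose root lies below v, and
-- B(v) = L(v) / (D − 2 dist(r,v)); as t has length at most D, B(r) ≤ 1.  Call v a hub if it is r or an
-- exit vertex.  Going up from the leaves, the reduced lengths of the components below a hub v sum to at
-- most B(v): these components are the ones rooted at v together with, for each such c, those below its
-- exit e_c, and  ℓ̄(s_c) + B(e_c) ≤ (length(s_c) + L(e_c)) / (D − 2 dist(r,v)).
-- For an ending subtour L(e_c) = 0 and this is an equality.  For a passing one it is  x/(N − k) ≤ (k + x)/N
-- for k + x ≤ N,  with N = D − 2 dist(r,r_c) and k = 2 dist(r_c,e_c) ≤ length(s_c): the edges above r_c,
-- those of c and those below e_c are disjoint, and t walks twice over the first ones and over the path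
-- from r_c to e_c.  At the root this bounds the sum over all components, hence over the visited ones.
module Submission where

open import Defs
open import Algebra.Bundles using (CommutativeMonoid)
open import Data.Bool using (Bool; true; false; if_then_else_; _∧_; _∨_)
import Data.Bool
open import Data.Bool.Properties using (T-∨; T-∧; T-≡)
open import Function.Bundles using (_⇔_; mk⇔; Equivalence)
open import Data.Fin as Fin using (Fin; zero; suc; toℕ; punchIn)
open import Data.Fin.Properties using (punchInᵢ≢i; toℕ-injective; suc-injective; toℕ<n)
open import Data.List using (List; []; _∷_; map; foldr; tabulate; allFin)
open import Data.List.Properties using (map-tabulate)
open import Data.List.Membership.Propositional using (_∈_)
open import Data.List.Relation.Unary.Any as Any using (here; there; satisfied)
open import Data.List.Relation.Unary.Any.Properties using (any⁺; any⁻)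
open import Data.List.Membership.Propositional.Properties using (∈-allFin)
open import Data.List.Relation.Unary.All as All using (All)
open import Data.List.Relation.Unary.AllPairs using ([]; _∷_)
open import Data.List.Relation.Unary.Unique.Propositional using (Unique)
import Data.List.Membership.DecPropositional
open import Data.Nat as ℕ using (ℕ; zero; suc; _≤_; _<_; z≤n; s≤s; _<ᵇ_)
import Data.Nat.Properties as ℕP
open import Data.Vec.Functional using (Vector)
open import Function using (_∘_; case_of_)
open import Relation.Binary using (Rel; Reflexive; _Preserves₂_⟶_⟶_)
open import Relation.Binary.PropositionalEquality
  using (_≡_; _≢_; refl; sym; trans; cong; cong₂; subst; subst₂; module ≡-Reasoning)
open import Relation.Nullary using (¬_; Dec; yes; no; does)
open import Relation.Nullary.Decidable using (dec-true; dec-false; _×-dec_; ¬?)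
open import Data.Maybe using (Maybe; just; nothing)
open import Data.Maybe.Properties using (just-injective)
import Data.Integer as ℤ
import Data.Integer.Properties as ℤP
open import Data.Rational as ℚ using (ℚ; 0ℚ; 1ℚ; toℚᵘ) renaming (_≤_ to _≤ℚ_)
import Data.Rational.Properties as ℚP
open import Data.Rational.Unnormalised as ℚᵘ using (mkℚᵘ; *≡*; *≤*)
import Data.Rational.Unnormalised.Properties as ℚᵘP
open import Data.Empty using (⊥-elim)
open import Data.Product using (∃; _×_; _,_; proj₁; proj₂)
open import Data.Sum using (_⊎_; inj₁; inj₂; [_,_]′)

module IndicatorSum {c ℓ} (M : CommutativeMonoid c ℓ) where
  open CommutativeMonoid M
    renaming (_∙_ to _+_; ε to 0#; refl to ≈-refl; sym to ≈-sym; trans to ≈-trans)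
  open import Algebra.Properties.CommutativeMonoid.Sum M public
  open import Relation.Binary.Reasoning.Setoid setoid

  when : Bool → Carrier → Carrier
  when b x = if b then x else 0#

  when-+ : ∀ b x y → when b (x + y) ≈ when b x + when b y
  when-+ true  x y = ≈-refl
  when-+ false x y = ≈-sym (identityˡ 0#)

  when-0 : ∀ b → when b 0# ≡ 0#
  when-0 true  = refl
  when-0 false = refl

  when-cong : ∀ b {x y} → x ≈ y → when b x ≈ when b y
  when-cong true  x≈y = x≈y
  when-cong false _   = ≈-refl

  when-yes : ∀ {p} {P : Set p} (P? : Dec P) x → P → when (does P?) x ≡ x
  when-yes P? x p rewrite dec-true P? p = refl

  when-no : ∀ {p} {P : Set p} (P? : Dec P) x → ¬ P → when (does P?) x ≡ 0#
  when-no P? x ¬p rewrite dec-false P? ¬p = refl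

  when-sum : ∀ {n} b (f : Vector Carrier n) → when b (sum f) ≈ ∑[ i < n ] when b (f i)
  when-sum true  f = ≈-refl
  when-sum {n} false f = ≈-sym (sum-replicate-zero n)

  sum-zero : ∀ {n} (f : Vector Carrier n) → (∀ i → f i ≈ 0#) → sum f ≈ 0#
  sum-zero {n} f f≈0 = ≈-trans (sum-cong-≋ f≈0) (sum-replicate-zero n)

  sum-single : ∀ {n} (a : Fin n) (f : Vector Carrier n) → (∀ i → i ≢ a → f i ≈ 0#) → sum f ≈ f a
  sum-single {suc n} a f f≈0 = begin
    sum f                                        ≈⟨ sum-remove f ⟩
    f a + ∑[ j < n ] f (punchIn a j)             ≈⟨ ∙-congˡ (sum-zero _ (λ j → f≈0 _ (punchInᵢ≢i a j))) ⟩
    f a + 0#                                     ≈⟨ identityʳ (f a) ⟩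
    f a                                          ∎

  sum-when-≡ : ∀ {n} (a : Fin n) (f : Vector Carrier n) → ∑[ i < n ] when (does (i Fin.≟ a)) (f i) ≈ f a
  sum-when-≡ a f = ≈-trans (sum-single a _ λ i i≢a → reflexive (when-no (i Fin.≟ a) (f i) i≢a))
                           (reflexive (when-yes (a Fin.≟ a) (f a) refl))

  module Monotone {r} (_≤_ : Rel Carrier r) (≤-refl : Reflexive _≤_) (+-mono : _+_ Preserves₂ _≤_ ⟶ _≤_ ⟶ _≤_) where
    when-mono : ∀ b {x y} → x ≤ y → when b x ≤ when b y
    when-mono true  x≤y = x≤y
    when-mono false _   = ≤-refl

    when≤ : ∀ b {x} → 0# ≤ x → when b x ≤ x
    when≤ true  _    = ≤-refl
    when≤ false 0≤x = 0≤x

    sum-mono : ∀ {n} {f g : Vector Carrier n} → (∀ i → f i ≤ g i) → sum f ≤ sum g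
    sum-mono {zero}  f≤g = ≤-refl
    sum-mono {suc n} f≤g = +-mono (f≤g zero) (sum-mono (f≤g ∘ suc))

  foldr-tabulate : ∀ {n} (f : Vector Carrier n) → foldr _+_ 0# (tabulate f) ≡ sum f
  foldr-tabulate {zero}  f = refl
  foldr-tabulate {suc n} f = cong (f zero +_) (foldr-tabulate (f ∘ suc))

  foldr-map-allFin : ∀ {n} (f : Vector Carrier n) → foldr _+_ 0# (map f (allFin n)) ≡ sum f
  foldr-map-allFin {n} f = trans (cong (foldr _+_ 0#) (map-tabulate (λ i → i) f)) (foldr-tabulate f)

  module _ {m : ℕ} where
    open Data.List.Membership.DecPropositional (Fin._≟_ {m}) using (_∈?_)

    foldr-map-unique : (f : Vector Carrier m) (cs : List (Fin m)) → Unique cs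
                     → foldr _+_ 0# (map f cs) ≈ ∑[ c < m ] when (does (c ∈? cs)) (f c)
    foldr-map-unique f []       _            = ≈-sym (sum-replicate-zero m)
    foldr-map-unique f (a ∷ cs) (a∉cs ∷ !cs) = begin
      f a + foldr _+_ 0# (map f cs)
        ≈⟨ ∙-cong (≈-sym (sum-when-≡ a f)) (foldr-map-unique f cs !cs) ⟩
      ∑[ c < m ] when (does (c Fin.≟ a)) (f c) + ∑[ c < m ] when (does (c ∈? cs)) (f c)
        ≈⟨ ≈-sym (∑-distrib-+ (λ c → when (does (c Fin.≟ a)) (f c)) _) ⟩
      ∑[ c < m ] (when (does (c Fin.≟ a)) (f c) + when (does (c ∈? cs)) (f c))
        ≈⟨ sum-cong-≋ (λ c → split c (c Fin.≟ a) (c ∈? cs)) ⟩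
      ∑[ c < m ] when (does (c ∈? (a ∷ cs))) (f c) ∎
      where
      split : ∀ c → (c≟a : Dec (c ≡ a)) (c∈?cs : Dec (c ∈ cs))
            → when (does c≟a) (f c) + when (does c∈?cs) (f c) ≈ when (does (c ∈? (a ∷ cs))) (f c)
      split c (yes refl) (yes c∈cs) = ⊥-elim (All.lookup a∉cs c∈cs refl)
      split c (yes refl) (no _)     = ≈-trans (identityʳ (f c)) (reflexive (sym (when-yes (c ∈? (a ∷ cs)) (f c) (here refl))))
      split c (no _)     (yes c∈cs) = ≈-trans (identityˡ (f c)) (reflexive (sym (when-yes (c ∈? (a ∷ cs)) (f c) (there c∈cs))))
      split c (no c≢a)   (no c∉cs)  = ≈-trans (identityˡ 0#) (reflexive (sym (when-no (c ∈? (a ∷ cs)) (f c) λ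
        { (here c≡a) → c≢a c≡a ; (there c∈cs) → c∉cs c∈cs })))

module ℕ∑ = IndicatorSum ℕP.+-0-commutativeMonoid
module ℕ∑≤ = ℕ∑.Monotone _≤_ ℕP.≤-refl ℕP.+-mono-≤
module ℚ∑ = IndicatorSum ℚP.+-0-commutativeMonoid
module ℚ∑≤ = ℚ∑.Monotone _≤ℚ_ ℚP.≤-refl ℚP.+-mono-≤

T-does⇒ : ∀ {p} {A : Set p} (A? : Dec A) → Data.Bool.T (does A?) → A
T-does⇒ (yes a) _ = a

module Ancestry (T : Tree) where
  open Tree T
  open import Data.Nat using (_+_)
  open ℕ∑

  infix 4 _⊑_
  _⊑_ : Vertex T → Vertex T → Set
  _⊑_ = _≼_ T

  ⊑⇒toℕ≤ : ∀ {u v} → u ⊑ v → toℕ u ≤ toℕ v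
  ⊑⇒toℕ≤ ≼-refl             = ℕP.≤-refl
  ⊑⇒toℕ≤ (≼-step {i} u⊑pi) = ℕP.≤-trans (⊑⇒toℕ≤ u⊑pi) (ℕP.m≤n⇒m≤1+n (parent-< i))

  ⊑-antisym : ∀ {u v} → u ⊑ v → v ⊑ u → u ≡ v
  ⊑-antisym u⊑v v⊑u = toℕ-injective (ℕP.≤-antisym (⊑⇒toℕ≤ u⊑v) (⊑⇒toℕ≤ v⊑u))

  ⊑-trans : ∀ {u v x} → u ⊑ v → v ⊑ x → u ⊑ x
  ⊑-trans u⊑v ≼-refl       = u⊑v
  ⊑-trans u⊑v (≼-step v⊑p) = ≼-step (⊑-trans u⊑v v⊑p)

  suc⊑⇒⋢parent : ∀ {i u} → suc i ⊑ u → ¬ u ⊑ parent i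
  suc⊑⇒⋢parent {i} si⊑u u⊑pi = ℕP.1+n≰n (ℕP.≤-trans (⊑⇒toℕ≤ si⊑u) (ℕP.≤-trans (⊑⇒toℕ≤ u⊑pi) (parent-< i)))

  ⊑root⇒≡root : ∀ {u} → u ⊑ root T → u ≡ root T
  ⊑root⇒≡root ≼-refl = refl

  ⊑suc-inv : ∀ {u i} → u ⊑ suc i → u ≡ suc i ⊎ u ⊑ parent i
  ⊑suc-inv ≼-refl        = inj₁ refl
  ⊑suc-inv (≼-step u⊑pi) = inj₂ u⊑pi

  ⊏-inv : ∀ {u v} → u ⊑ v → u ≢ v → ∃ λ i → v ≡ suc i × u ⊑ parent i
  ⊏-inv ≼-refl            u≢v = ⊥-elim (u≢v refl)
  ⊏-inv (≼-step {i} u⊑pi) _   = i , refl , u⊑pi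

  ⊏⇒toℕ< : ∀ {u v} → u ⊑ v → u ≢ v → toℕ u < toℕ v
  ⊏⇒toℕ< u⊑v u≢v with ⊏-inv u⊑v u≢v
  ... | i , refl , u⊑pi = s≤s (ℕP.≤-trans (⊑⇒toℕ≤ u⊑pi) (parent-< i))

  ⊑-total-below : ∀ {u v x} → u ⊑ x → v ⊑ x → u ⊑ v ⊎ v ⊑ u
  ⊑-total-below ≼-refl        v⊑x = inj₂ v⊑x
  ⊑-total-below (≼-step u⊑pi) v⊑x with ⊑suc-inv v⊑x
  ... | inj₁ refl = inj₁ (≼-step u⊑pi)
  ... | inj₂ v⊑pi = ⊑-total-below u⊑pi v⊑pi

  root-⊑ : ∀ v → root T ⊑ v
  root-⊑ v = go (suc (toℕ v)) v ℕP.≤-refl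
    where
    go : ∀ k v → toℕ v < k → root T ⊑ v
    go (suc k) zero    _         = ≼-refl
    go (suc k) (suc i) (s≤s i<k) = ≼-step (go k (parent i) (ℕP.≤-trans (s≤s (parent-< i)) i<k))

  infix 4 _⊑?_
  _⊑?_ : ∀ u v → Dec (u ⊑ v)
  u ⊑? v = go (suc (toℕ v)) v ℕP.≤-refl
    where
    go : ∀ k v → toℕ v < k → Dec (u ⊑ v)
    go (suc k) v v<k with u Fin.≟ v
    ... | yes refl = yes ≼-refl
    go (suc k) zero    _         | no u≢v = no (u≢v ∘ ⊑root⇒≡root)
    go (suc k) (suc i) (s≤s i<k) | no u≢i with go k (parent i) (ℕP.≤-trans (s≤s (parent-< i)) i<k)
    ... | yes u⊑pi = yes (≼-step u⊑pi)
    ... | no  u⋢pi = no ([ u≢i , u⋢pi ]′ ∘ ⊑suc-inv)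

  depth-suc : ∀ i → depth T (suc i) ≡ w i + depth T (parent i)
  depth-suc i = cong (w i +_) (fuel-irrelevant (toℕ i) (toℕ (parent i)) (parent i) (parent-< i) ℕP.≤-refl)
    where
    fuel-irrelevant : ∀ k k′ v → toℕ v ≤ k → toℕ v ≤ k′ → depthF T k v ≡ depthF T k′ v
    fuel-irrelevant zero    zero     zero    _       _        = refl
    fuel-irrelevant zero    (suc k′) zero    _       _        = refl
    fuel-irrelevant (suc k) zero     zero    _       _        = refl
    fuel-irrelevant (suc k) (suc k′) zero    _       _        = refl
    fuel-irrelevant (suc k) (suc k′) (suc i) (s≤s h) (s≤s h′) =
      cong (w i +_) (fuel-irrelevant k k′ (parent i) (ℕP.≤-trans (parent-< i) h) (ℕP.≤-trans (parent-< i) h′))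

  depth≡∑-above : ∀ v → depth T v ≡ ∑[ e < n ] when (does (suc e ⊑? v)) (w e)
  depth≡∑-above v = go (suc (toℕ v)) v ℕP.≤-refl
    where
    split : ∀ i e → (e≟i : Dec (e ≡ i))
          → when (does e≟i) (w e) + when (does (suc e ⊑? parent i)) (w e) ≡ when (does (suc e ⊑? suc i)) (w e)
    split i e (yes refl) = begin
      w e + when (does (suc e ⊑? parent e)) (w e) ≡⟨ cong (w e +_) (when-no (suc e ⊑? parent e) (w e) (suc⊑⇒⋢parent ≼-refl)) ⟩
      w e + 0                                     ≡⟨ ℕP.+-identityʳ (w e) ⟩
      w e                                         ≡⟨ when-yes (suc e ⊑? suc e) (w e) ≼-refl ⟨
      when (does (suc e ⊑? suc e)) (w e)          ∎
      where open ≡-Reasoning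
    split i e (no e≢i) with suc e ⊑? parent i
    ... | yes se⊑pi = sym (when-yes (suc e ⊑? suc i) (w e) (≼-step se⊑pi))
    ... | no  se⋢pi = sym (when-no (suc e ⊑? suc i) (w e) ([ e≢i ∘ suc-injective , se⋢pi ]′ ∘ ⊑suc-inv))
    go : ∀ k v → toℕ v < k → depth T v ≡ ∑[ e < n ] when (does (suc e ⊑? v)) (w e)
    go (suc k) zero    _         = sym (sum-zero _ λ e → when-no (suc e ⊑? zero) (w e) (λ se⊑0 → case ⊑root⇒≡root se⊑0 of λ ()))
    go (suc k) (suc i) (s≤s i<k) = begin
      depth T (suc i)                    ≡⟨ depth-suc i ⟩
      w i + depth T (parent i)           ≡⟨ cong₂ _+_ (sym (sum-when-≡ i w)) (go k (parent i) (ℕP.≤-trans (s≤s (parent-< i)) i<k)) ⟩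
      ∑[ e < n ] when (does (e Fin.≟ i)) (w e) + ∑[ e < n ] when (does (suc e ⊑? parent i)) (w e)
                                         ≡⟨ ∑-distrib-+ (λ e → when (does (e Fin.≟ i)) (w e)) _ ⟨
      ∑[ e < n ] (when (does (e Fin.≟ i)) (w e) + when (does (suc e ⊑? parent i)) (w e))
                                         ≡⟨ sum-cong-≗ (λ e → split i e (e Fin.≟ i)) ⟩
      ∑[ e < n ] when (does (suc e ⊑? suc i)) (w e) ∎
      where open ≡-Reasoning

  pathWeight : Vertex T → Vertex T → ℕ
  pathWeight v x = ∑[ e < n ] when (does (suc e ⊑? x ×-dec ¬? (suc e ⊑? v))) (w e)

  depth-via : ∀ {v x} → v ⊑ x → depth T x ≡ depth T v + pathWeight v x
  depth-via {v} {x} v⊑x = begin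
    depth T x                                                    ≡⟨ depth≡∑-above x ⟩
    ∑[ e < n ] when (does (suc e ⊑? x)) (w e)                    ≡⟨ sum-cong-≗ (λ e → split e (suc e ⊑? v) (suc e ⊑? x)) ⟩
    ∑[ e < n ] (when (does (suc e ⊑? v)) (w e) + when (does (suc e ⊑? x ×-dec ¬? (suc e ⊑? v))) (w e))
                                                                 ≡⟨ ∑-distrib-+ (λ e → when (does (suc e ⊑? v)) (w e)) _ ⟩
    ∑[ e < n ] when (does (suc e ⊑? v)) (w e) + pathWeight v x   ≡⟨ cong (_+ pathWeight v x) (depth≡∑-above v) ⟨
    depth T v + pathWeight v x                                   ∎
    where
    open ≡-Reasoning
    split : ∀ e (above-v : Dec (suc e ⊑ v)) (above-x : Dec (suc e ⊑ x))
          → when (does above-x) (w e) ≡ when (does above-v) (w e) + when (does (above-x ×-dec ¬? above-v)) (w e)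
    split e (yes _)      (yes _)      = sym (ℕP.+-identityʳ (w e))
    split e (yes se⊑v)   (no se⋢x)    = ⊥-elim (se⋢x (⊑-trans se⊑v v⊑x))
    split e (no _)       (yes _)      = refl
    split e (no _)       (no _)       = refl

module Traversal (T : Tree) (t : Tour T) where
  open Tree T
  open Ancestry T
  open import Data.Nat using (_+_)

  traversals : Fin n → ℕ
  traversals e = trav T e (walk t)

  traversals≡0⊎2 : ∀ e → traversals e ≡ 0 ⊎ traversals e ≡ 2
  traversals≡0⊎2 e with twice t e
  ... | inj₁ (up≡0 , down≡0) = inj₁ (cong₂ _+_ up≡0 down≡0)
  ... | inj₂ (up≡1 , down≡1) = inj₂ (cong₂ _+_ up≡1 down≡1)

  traversed⇒≡2 : ∀ e → 0 < traversals e → traversals e ≡ 2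
  traversed⇒≡2 e 0<τ with traversals≡0⊎2 e
  ... | inj₁ τ≡0 = ⊥-elim (ℕP.<-irrefl (sym τ≡0) 0<τ)
  ... | inj₂ τ≡2 = τ≡2

  ∈⇒0<count : ∀ a b ss → (a , b) ∈ ss → 0 < count T a b ss
  ∈⇒0<count a b (_ ∷ ss) (here refl)
    rewrite dec-true (a Fin.≟ a) refl | dec-true (b Fin.≟ b) refl = s≤s z≤n
  ∈⇒0<count a b (_ ∷ ss) (there ab∈ss) = ℕP.≤-trans (∈⇒0<count a b ss ab∈ss) (ℕP.m≤n+m _ _)

  0<count⇒∈ : ∀ a b ss → 0 < count T a b ss → (a , b) ∈ ss
  0<count⇒∈ a b ((x , y) ∷ ss) 0<c with x Fin.≟ a | y Fin.≟ b
  ... | yes refl | yes refl = here refl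
  ... | yes _    | no _     = there (0<count⇒∈ a b ss 0<c)
  ... | no _     | _        = there (0<count⇒∈ a b ss 0<c)

  ∈steps⇒∈ˡ : ∀ {a b} xs → (a , b) ∈ steps T xs → a ∈ xs
  ∈steps⇒∈ˡ (x ∷ y ∷ xs) (here refl) = here refl
  ∈steps⇒∈ˡ (x ∷ y ∷ xs) (there ab∈) = there (∈steps⇒∈ˡ (y ∷ xs) ab∈)

  ∈steps⇒∈ʳ : ∀ {a b} xs → (a , b) ∈ steps T xs → b ∈ xs
  ∈steps⇒∈ʳ (x ∷ y ∷ xs) (here refl) = there (here refl)
  ∈steps⇒∈ʳ (x ∷ y ∷ xs) (there ab∈) = there (∈steps⇒∈ʳ (y ∷ xs) ab∈)

  entering-step : ∀ {p} {S : Vertex T → Set p} → (∀ u → Dec (S u)) → ∀ x xs → ¬ S x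
                → ∀ {y} → y ∈ x ∷ xs → S y → ∃ λ ab → ab ∈ steps T (x ∷ xs) × ¬ S (proj₁ ab) × S (proj₂ ab)
  entering-step S? x []       ¬Sx (here refl) Sy = ⊥-elim (¬Sx Sy)
  entering-step S? x (z ∷ zs) ¬Sx y∈ Sy with S? z | y∈
  ... | yes Sz  | _           = (x , z) , here refl , ¬Sx , Sz
  ... | no  _   | here refl   = ⊥-elim (¬Sx Sy)
  ... | no  ¬Sz | there y∈zzs with entering-step S? z zs ¬Sz y∈zzs Sy
  ...   | ab , ab∈ , ¬Sa , Sb = ab , there ab∈ , ¬Sa , Sb

  traversed⇒visited : ∀ e → 0 < traversals e → suc e ∈ walk t
  traversed⇒visited e 0<τ with upCount T e (walk t) in up≡
  ... | suc _ = ∈steps⇒∈ˡ (walk t) (0<count⇒∈ _ _ (steps T (walk t)) (subst (0 <_) (sym up≡) (s≤s z≤n)))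
  ... | zero  = ∈steps⇒∈ʳ (walk t) (0<count⇒∈ _ _ (steps T (walk t)) 0<τ)

  -- The walk starts at the root, outside the subtree of suc f, and reaches suc e inside it; the step
  -- entering that subtree can only go down edge f.
  traversed-upward-closed : ∀ e f → 0 < traversals e → suc f ⊑ suc e → 0 < traversals f
  traversed-upward-closed e f 0<τe sf⊑se with starts t
  ... | xs , walk≡ with entering-step (suc f ⊑?_) (root T) xs (λ sf⊑0 → case ⊑root⇒≡root sf⊑0 of λ ())
                          (subst (suc e ∈_) walk≡ (traversed⇒visited e 0<τe)) sf⊑se
  ... | (a , b) , ab∈ , sf⋢a , sf⊑b with All.lookup (adjacent t) (subst (λ ws → (a , b) ∈ steps T ws) (sym walk≡) ab∈)
  ...   | g , inj₁ (refl , refl) = ⊥-elim (sf⋢a (≼-step sf⊑b))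
  ...   | g , inj₂ (refl , refl) with ⊑suc-inv sf⊑b
  ...     | inj₂ sf⊑pg = ⊥-elim (sf⋢a sf⊑pg)
  ...     | inj₁ sf≡sg with suc-injective sf≡sg
  ...       | refl = ℕP.≤-trans (∈⇒0<count (parent f) (suc f) (steps T (walk t)) (subst (λ ws → (parent f , suc f) ∈ steps T ws) (sym walk≡) ab∈))
                                (ℕP.m≤n+m _ _)

module Components (T : Tree) (P : Partition T) where
  open Tree T
  open Ancestry T
  open Partition P

  InC : Fin m → Vertex T → Set
  InC = InV T comp

  suc∈comp : ∀ e → InC (comp e) (suc e)
  suc∈comp e = e , refl , inj₁ refl

  parent∈comp : ∀ e → InC (comp e) (parent e)
  parent∈comp e = e , refl , inj₂ refl

  rt⊑parent : ∀ e → rt (comp e) ⊑ parent e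
  rt⊑parent e = rt-top (comp e) (parent e) (parent∈comp e)

  comp-on-path : ∀ c y f → InC c y → rt c ⊑ parent f → suc f ⊑ y → comp f ≡ c
  comp-on-path c y f y∈c rc⊑pf sf⊑y = crossing (connected c (rt c) y (rt-in c) y∈c) (λ sf⊑rc → suc⊑⇒⋢parent sf⊑rc rc⊑pf) sf⊑y
    where
    crossing : ∀ {u x} → PathIn T comp c u x → ¬ suc f ⊑ u → suc f ⊑ x → comp f ≡ c
    crossing here sf⋢u sf⊑x = ⊥-elim (sf⋢u sf⊑x)
    crossing (there {x = z} e ce≡c step path) sf⋢u sf⊑x with suc f ⊑? z
    ... | no sf⋢z = crossing path sf⋢z sf⊑x
    ... | yes sf⊑z with step
    ...   | inj₁ (refl , refl) = ⊥-elim (sf⋢u (≼-step sf⊑z))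
    ...   | inj₂ (refl , refl) with ⊑suc-inv sf⊑z
    ...     | inj₂ sf⊑pe = ⊥-elim (sf⋢u sf⊑pe)
    ...     | inj₁ sf≡se with suc-injective sf≡se
    ...       | refl = ce≡c

  record IsExit (c : Fin m) (x : Vertex T) : Set where
    field
      exit∈comp  : InC c x
      exit≢root  : x ≢ rt c
      exit-only-shared : ∀ c′ v → c′ ≢ c → InC c v → InC c′ v → v ≡ rt c ⊎ v ≡ x

  isExit : ∀ c x → ex c ≡ just x → IsExit c x
  isExit c x ex≡ with ex c | ex-spec c | ex≡
  ... | just .x | internal .x _ x∈c x≢rc _ shared | refl = record
    { exit∈comp = x∈c ; exit≢root = x≢rc ; exit-only-shared = shared }

  rt⊑exit : ∀ c x → ex c ≡ just x → rt c ⊑ x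
  rt⊑exit c x ex≡ = rt-top c x (IsExit.exit∈comp (isExit c x ex≡))

  rt⊏exit : ∀ c x → ex c ≡ just x → toℕ (rt c) < toℕ x
  rt⊏exit c x ex≡ = ⊏⇒toℕ< (rt⊑exit c x ex≡) (IsExit.exit≢root (isExit c x ex≡) ∘ sym)

  exit-edge : ∀ c x → ex c ≡ just x → ∃ λ k → x ≡ suc k × comp k ≡ c × rt c ⊑ parent k
  exit-edge c x ex≡ with ⊏-inv (rt⊑exit c x ex≡) (IsExit.exit≢root (isExit c x ex≡) ∘ sym)
  ... | k , x≡sk , rc⊑pk =
    k , x≡sk , comp-on-path c x k (IsExit.exit∈comp (isExit c x ex≡)) rc⊑pk (subst (suc k ⊑_) (sym x≡sk) ≼-refl) , rc⊑pk

  Hub : Vertex T → Set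
  Hub v = v ≡ root T ⊎ ∃ λ c → ex c ≡ just v

  comp-above-root≢ : ∀ c′ j → rt c′ ≡ suc j → comp j ≢ c′
  comp-above-root≢ c′ j rc′≡sj cj≡c′ = suc⊑⇒⋢parent ≼-refl
    (subst (_⊑ parent j) rc′≡sj (rt-top c′ (parent j) (subst (λ c → InC c (parent j)) cj≡c′ (parent∈comp j))))

  rt-above-root< : ∀ c′ j → rt c′ ≡ suc j → toℕ (rt (comp j)) < toℕ (rt c′)
  rt-above-root< c′ j rc′≡sj = subst (λ u → toℕ (rt (comp j)) < toℕ u) (sym rc′≡sj)
    (s≤s (ℕP.≤-trans (⊑⇒toℕ≤ (rt⊑parent j)) (parent-< j)))

  exit-above-root : ∀ c′ j → rt c′ ≡ suc j → ex (comp j) ≡ just (rt c′)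
  exit-above-root c′ j rc′≡sj with ex (comp j) | ex-spec (comp j)
  ... | nothing | leaf isLeaf with nonempty c′
  ...   | e , ce≡c′ = ⊥-elim (comp-above-root≢ c′ j rc′≡sj (trans (sym ce≡comp) ce≡c′))
    where
    rp⊑pe : rt (comp j) ⊑ parent e
    rp⊑pe = ⊑-trans (≼-step (rt⊑parent j)) (subst (_⊑ parent e) rc′≡sj (rt-top c′ (parent e) (e , ce≡c′ , inj₂ refl)))
    ce≡comp : comp e ≡ comp j
    ce≡comp = comp-on-path (comp j) (suc e) e (isLeaf (suc e) (≼-step rp⊑pe)) rp⊑pe ≼-refl
  exit-above-root c′ j rc′≡sj | just x | internal .x _ _ _ _ shared
    with shared c′ (suc j) (comp-above-root≢ c′ j rc′≡sj ∘ sym) (suc∈comp j) (subst (InC c′) rc′≡sj (rt-in c′))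
  ... | inj₁ sj≡rp = ⊥-elim (suc⊑⇒⋢parent ≼-refl (subst (_⊑ parent j) (sym sj≡rp) (rt⊑parent j)))
  ... | inj₂ sj≡x  = cong just (trans (sym sj≡x) (sym rc′≡sj))

  hub-not-inside : ∀ c x v → ex c ≡ just x → Hub v → rt c ⊑ v → v ⊑ x → v ≡ rt c ⊎ v ≡ x
  hub-not-inside c x v ex≡ hub rc⊑v v⊑x with v Fin.≟ rt c
  ... | yes v≡rc = inj₁ v≡rc
  ... | no  v≢rc with ⊏-inv rc⊑v (v≢rc ∘ sym)
  ...   | k , v≡sk , rc⊑pk = inj₂ (from-hub hub)
    where
    open IsExit (isExit c x ex≡)
    v∈c : InC c v
    v∈c = k , comp-on-path c x k exit∈comp rc⊑pk (subst (_⊑ x) v≡sk v⊑x) , inj₁ v≡sk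
    from-hub : Hub v → v ≡ x
    from-hub (inj₁ v≡0) = case trans (sym v≡sk) v≡0 of λ ()
    from-hub (inj₂ (c₀ , ex₀≡)) with c₀ Fin.≟ c
    ... | yes refl = just-injective (trans (sym ex₀≡) ex≡)
    ... | no c₀≢c  with exit-only-shared c₀ v c₀≢c v∈c (IsExit.exit∈comp (isExit c₀ v ex₀≡))
    ...   | inj₁ v≡rc = ⊥-elim (v≢rc v≡rc)
    ...   | inj₂ v≡x  = v≡x

  -- The component just above rt c′ exits at rt c′, and a hub never lies strictly inside a root–exit path.
  exit-between : ∀ v c′ → Hub v → v ⊑ rt c′ → v ≢ rt c′
               → ∃ λ c → rt c ≡ v × ∃ λ x → ex c ≡ just x × x ⊑ rt c′
  exit-between v c′ hub = go (suc (toℕ (rt c′))) c′ ℕP.≤-refl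
    where
    go : ∀ k c′ → toℕ (rt c′) < k → v ⊑ rt c′ → v ≢ rt c′ → ∃ λ c → rt c ≡ v × ∃ λ x → ex c ≡ just x × x ⊑ rt c′
    go (suc k) c′ (s≤s rc′≤k) v⊑rc′ v≢rc′ with ⊏-inv v⊑rc′ v≢rc′
    ... | j , rc′≡sj , v⊑pj with rt (comp j) ⊑? v
    ...   | yes rp⊑v = [ (λ v≡rp → comp j , sym v≡rp , rt c′ , exit-above-root c′ j rc′≡sj , ≼-refl)
                       , (λ v≡rc′ → ⊥-elim (v≢rc′ v≡rc′)) ]′
                       (hub-not-inside (comp j) (rt c′) v (exit-above-root c′ j rc′≡sj) hub rp⊑v v⊑rc′)
    ...   | no  rp⋢v with ⊑-total-below v⊑pj (rt⊑parent j)
    ...     | inj₂ rp⊑v = ⊥-elim (rp⋢v rp⊑v)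
    ...     | inj₁ v⊑rp with go k (comp j) (ℕP.<-≤-trans (rt-above-root< c′ j rc′≡sj) rc′≤k) v⊑rp
                                (λ v≡rp → rp⋢v (subst (_⊑ v) v≡rp ≼-refl))
    ...       | c , rc≡v , x , ex≡ , x⊑rp =
      c , rc≡v , x , ex≡ , ⊑-trans x⊑rp (⊑-trans (rt⊑parent j) (subst (parent j ⊑_) (sym rc′≡sj) (≼-step ≼-refl)))

  exits-comparable⇒≡ : ∀ c₁ c₂ x₁ x₂ → rt c₁ ≡ rt c₂ → ex c₁ ≡ just x₁ → ex c₂ ≡ just x₂ → x₁ ⊑ x₂ → c₁ ≡ c₂
  exits-comparable⇒≡ c₁ c₂ x₁ x₂ r₁≡r₂ ex₁≡ ex₂≡ x₁⊑x₂ with exit-edge c₁ x₁ ex₁≡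
  ... | k , x₁≡sk , ck≡c₁ , r₁⊑pk = trans (sym ck≡c₁)
    (comp-on-path c₂ x₂ k (IsExit.exit∈comp (isExit c₂ x₂ ex₂≡)) (subst (_⊑ parent k) r₁≡r₂ r₁⊑pk) (subst (_⊑ x₂) x₁≡sk x₁⊑x₂))

  exits-below⇒≡ : ∀ c₁ c₂ x₁ x₂ y → rt c₁ ≡ rt c₂ → ex c₁ ≡ just x₁ → ex c₂ ≡ just x₂ → x₁ ⊑ y → x₂ ⊑ y → c₁ ≡ c₂
  exits-below⇒≡ c₁ c₂ x₁ x₂ y r₁≡r₂ ex₁≡ ex₂≡ x₁⊑y x₂⊑y with ⊑-total-below x₁⊑y x₂⊑y
  ... | inj₁ x₁⊑x₂ = exits-comparable⇒≡ c₁ c₂ x₁ x₂ r₁≡r₂ ex₁≡ ex₂≡ x₁⊑x₂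
  ... | inj₂ x₂⊑x₁ = sym (exits-comparable⇒≡ c₂ c₁ x₂ x₁ (sym r₁≡r₂) ex₂≡ ex₁≡ x₂⊑x₁)

module Decomposition (T : Tree) (P : Partition T) {a ℓ} (M : CommutativeMonoid a ℓ) where
  open Tree T
  open Ancestry T
  open Partition P
  open Components T P
  open CommutativeMonoid M
    renaming (_∙_ to _+_; ε to 0#; refl to ≈-refl; sym to ≈-sym; trans to ≈-trans)
  open IndicatorSum M
  open import Relation.Binary.Reasoning.Setoid setoid

  sumBelow : (Fin m → Carrier) → Vertex T → Carrier
  sumBelow f v = ∑[ c < m ] when (does (v ⊑? rt c)) (f c)

  sumBelowExit : (Fin m → Carrier) → Maybe (Vertex T) → Carrier
  sumBelowExit f nothing  = 0#
  sumBelowExit f (just x) = sumBelow f x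

  module _ (f : Fin m → Carrier) (v : Vertex T) (hub : Hub v) where
    belowExit : Maybe (Vertex T) → Fin m → Carrier
    belowExit nothing  c′ = 0#
    belowExit (just x) c′ = when (does (x ⊑? rt c′)) (f c′)

    sumBelowExit≈∑ : ∀ mx → sumBelowExit f mx ≈ ∑[ c′ < m ] belowExit mx c′
    sumBelowExit≈∑ nothing  = ≈-sym (sum-replicate-zero m)
    sumBelowExit≈∑ (just x) = ≈-refl

    belowExitOf : Fin m → Fin m → Carrier
    belowExitOf c c′ = when (does (rt c Fin.≟ v)) (belowExit (ex c) c′)

    belowExitOf-0 : ∀ c c′ → (∀ x → rt c ≡ v → ex c ≡ just x → ¬ x ⊑ rt c′) → belowExitOf c c′ ≡ 0#
    belowExitOf-0 c c′ never with rt c Fin.≟ v | ex c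
    ... | no _      | _       = refl
    ... | yes _     | nothing = refl
    ... | yes rc≡v  | just x  = when-no (x ⊑? rt c′) (f c′) (never x rc≡v refl)

    belowExitOf-f : ∀ c c′ x → rt c ≡ v → ex c ≡ just x → x ⊑ rt c′ → belowExitOf c c′ ≡ f c′
    belowExitOf-f c c′ x rc≡v ex≡ x⊑rc′ rewrite dec-true (rt c Fin.≟ v) rc≡v | ex≡ = when-yes (x ⊑? rt c′) (f c′) x⊑rc′

    split-below : ∀ c′ → when (does (v ⊑? rt c′)) (f c′) ≈ when (does (rt c′ Fin.≟ v)) (f c′) + ∑[ c < m ] belowExitOf c c′
    split-below c′ with rt c′ Fin.≟ v
    ... | yes rc′≡v = begin
      when (does (v ⊑? rt c′)) (f c′)  ≡⟨ when-yes (v ⊑? rt c′) (f c′) (subst (v ⊑_) (sym rc′≡v) ≼-refl) ⟩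
      f c′                             ≈⟨ identityʳ (f c′) ⟨
      f c′ + 0#                        ≈⟨ ∙-congˡ (sum-zero _ λ c → reflexive (belowExitOf-0 c c′ (exit-not-above rc′≡v c))) ⟨
      f c′ + ∑[ c < m ] belowExitOf c c′ ∎
      where
      exit-not-above : rt c′ ≡ v → ∀ c x → rt c ≡ v → ex c ≡ just x → ¬ x ⊑ rt c′
      exit-not-above rc′≡v c x rc≡v ex≡ x⊑rc′ = IsExit.exit≢root (isExit c x ex≡)
        (⊑-antisym (subst (x ⊑_) (trans rc′≡v (sym rc≡v)) x⊑rc′) (rt⊑exit c x ex≡))
    ... | no rc′≢v with v ⊑? rt c′
    ...   | no v⋢rc′ = ≈-sym (≈-trans (∙-congˡ (sum-zero _ λ c → reflexive (belowExitOf-0 c c′ λ x rc≡v ex≡ x⊑rc′ →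
                          v⋢rc′ (⊑-trans (subst (_⊑ x) rc≡v (rt⊑exit c x ex≡)) x⊑rc′)))) (identityˡ 0#))
    ...   | yes v⊑rc′ with exit-between v c′ hub v⊑rc′ (rc′≢v ∘ sym)
    ...     | c₀ , rc₀≡v , x₀ , ex₀≡ , x₀⊑rc′ = ≈-sym (≈-trans (identityˡ _) (≈-trans
                (sum-single c₀ _ λ c c≢c₀ → reflexive (belowExitOf-0 c c′ λ x rc≡v ex≡ x⊑rc′ →
                   c≢c₀ (exits-below⇒≡ c c₀ x x₀ (rt c′) (trans rc≡v (sym rc₀≡v)) ex≡ ex₀≡ x⊑rc′ x₀⊑rc′)))
                (reflexive (belowExitOf-f c₀ c′ x₀ rc₀≡v ex₀≡ x₀⊑rc′))))

  sumBelow-hub : ∀ f v → Hub v → sumBelow f v ≈ ∑[ c < m ] when (does (rt c Fin.≟ v)) (f c + sumBelowExit f (ex c))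
  sumBelow-hub f v hub = begin
    ∑[ c′ < m ] when (does (v ⊑? rt c′)) (f c′)
      ≈⟨ sum-cong-≋ (split-below f v hub) ⟩
    ∑[ c′ < m ] (when (does (rt c′ Fin.≟ v)) (f c′) + ∑[ c < m ] belowExitOf f v hub c c′)
      ≈⟨ ∑-distrib-+ (λ c′ → when (does (rt c′ Fin.≟ v)) (f c′)) _ ⟩
    ∑[ c < m ] when (does (rt c Fin.≟ v)) (f c) + ∑[ c′ < m ] ∑[ c < m ] belowExitOf f v hub c c′
      ≈⟨ ∙-congˡ (≈-sym (∑-comm (belowExitOf f v hub))) ⟩
    ∑[ c < m ] when (does (rt c Fin.≟ v)) (f c) + ∑[ c < m ] ∑[ c′ < m ] belowExitOf f v hub c c′
      ≈⟨ ∙-congˡ (sum-cong-≋ λ c → ≈-sym (≈-trans (when-cong (does (rt c Fin.≟ v)) (sumBelowExit≈∑ f v hub (ex c)))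
                                                   (when-sum (does (rt c Fin.≟ v)) (belowExit f v hub (ex c))))) ⟩
    ∑[ c < m ] when (does (rt c Fin.≟ v)) (f c) + ∑[ c < m ] when (does (rt c Fin.≟ v)) (sumBelowExit f (ex c))
      ≈⟨ ∑-distrib-+ (λ c → when (does (rt c Fin.≟ v)) (f c)) _ ⟨
    ∑[ c < m ] (when (does (rt c Fin.≟ v)) (f c) + when (does (rt c Fin.≟ v)) (sumBelowExit f (ex c)))
      ≈⟨ sum-cong-≋ (λ c → when-+ (does (rt c Fin.≟ v)) _ _) ⟨
    ∑[ c < m ] when (does (rt c Fin.≟ v)) (f c + sumBelowExit f (ex c)) ∎

module Fraction (T : Tree) (P : Partition T) where
  open import Data.Nat using (_+_; _*_; _∸_)
  open import Data.Integer using (+_)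
  open ℚ∑

  fr : ℕ → ℕ → ℚ
  fr a q = frac T P (+ a) q

  fr≃mkℚᵘ : ∀ a q → toℚᵘ (fr a (suc q)) ℚᵘ.≃ mkℚᵘ (+ a) q
  fr≃mkℚᵘ a q = ℚP.toℚᵘ-fromℚᵘ (mkℚᵘ (+ a) q)

  fr-cross-≤ : ∀ a q b q′ → a * suc q′ ≤ b * suc q → fr a (suc q) ≤ℚ fr b (suc q′)
  fr-cross-≤ a q b q′ aq′≤bq = ℚP.toℚᵘ-cancel-≤
    (ℚᵘP.≤-respˡ-≃ (ℚᵘP.≃-sym (fr≃mkℚᵘ a q)) (ℚᵘP.≤-respʳ-≃ (ℚᵘP.≃-sym (fr≃mkℚᵘ b q′))
      (*≤* (subst₂ ℤ._≤_ (ℤP.pos-* a (suc q′)) (ℤP.pos-* b (suc q)) (ℤ.+≤+ aq′≤bq)))))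

  fr-zero : ∀ q → fr 0 q ≡ 0ℚ
  fr-zero zero    = refl
  fr-zero (suc q) = ℚP.0/n≡0 (suc q)

  fr-+ : ∀ q a b → fr (a + b) q ≡ fr a q ℚ.+ fr b q
  fr-+ zero    a b = refl
  fr-+ (suc q) a b = ℚP.toℚᵘ-injective (ℚᵘP.≃-trans (fr≃mkℚᵘ (a + b) q) (ℚᵘP.≃-trans (*≡* cross)
    (ℚᵘP.≃-sym (ℚᵘP.≃-trans (ℚP.toℚᵘ-homo-+ (fr a (suc q)) (fr b (suc q))) (ℚᵘP.+-cong (fr≃mkℚᵘ a q) (fr≃mkℚᵘ b q))))))
    where
    open ≡-Reasoning
    s = suc q
    cross : + (a + b) ℤ.* + (s * s) ≡ (+ a ℤ.* + s ℤ.+ + b ℤ.* + s) ℤ.* + s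
    cross = begin
      + (a + b) ℤ.* + (s * s)           ≡⟨ ℤP.pos-* (a + b) (s * s) ⟨
      + ((a + b) * (s * s))             ≡⟨ cong +_ (ℕP.*-distribʳ-+ (s * s) a b) ⟩
      + (a * (s * s) + b * (s * s))     ≡⟨ cong₂ (λ x y → + (x + y)) (ℕP.*-assoc a s s) (ℕP.*-assoc b s s) ⟨
      + (a * s * s + b * s * s)         ≡⟨ cong +_ (ℕP.*-distribʳ-+ s (a * s) (b * s)) ⟨
      + ((a * s + b * s) * s)           ≡⟨ ℤP.pos-* (a * s + b * s) s ⟩
      + (a * s + b * s) ℤ.* + s         ≡⟨ cong (ℤ._* + s) (ℤP.pos-+ (a * s) (b * s)) ⟩
      (+ (a * s) ℤ.+ + (b * s)) ℤ.* + s ≡⟨ cong₂ (λ x y → (x ℤ.+ y) ℤ.* + s) (ℤP.pos-* a s) (ℤP.pos-* b s) ⟩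
      (+ a ℤ.* + s ℤ.+ + b ℤ.* + s) ℤ.* + s ∎

  fr-nonneg : ∀ a q → 0ℚ ≤ℚ fr a q
  fr-nonneg a zero    = ℚP.≤-refl
  fr-nonneg a (suc q) = subst (_≤ℚ fr a (suc q)) (fr-zero 1) (fr-cross-≤ 0 0 a q z≤n)

  fr≤1 : ∀ a q → a ≤ q → 0 < q → fr a q ≤ℚ 1ℚ
  fr≤1 a (suc q) a≤q _ = fr-cross-≤ a q 1 0 (subst₂ _≤_ (sym (ℕP.*-identityʳ a)) (sym (ℕP.*-identityˡ (suc q))) a≤q)

  fr-when : ∀ b a q → fr (ℕ∑.when b a) q ≡ when b (fr a q)
  fr-when true  a q = refl
  fr-when false a q = fr-zero q

  fr-sum : ∀ {k} q (g : Fin k → ℕ) → fr (ℕ∑.sum g) q ≡ ∑[ i < k ] fr (g i) q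
  fr-sum {zero}  q g = fr-zero q
  fr-sum {suc k} q g = trans (fr-+ q (g zero) _) (cong (fr (g zero) q ℚ.+_) (fr-sum q (g ∘ suc)))

  fr-sum-when : ∀ {k} q (b : Fin k → Bool) (g : Fin k → ℕ) → fr (ℕ∑.sum (λ i → ℕ∑.when (b i) (g i))) q ≡ ∑[ i < k ] when (b i) (fr (g i) q)
  fr-sum-when q b g = trans (fr-sum q (λ i → ℕ∑.when (b i) (g i))) (sum-cong-≗ λ i → fr-when (b i) (g i) q)

  fr-shift-≤ : ∀ k x N → k + x ≤ N → fr x (N ∸ k) ≤ℚ fr (k + x) N
  fr-shift-≤ k x N k+x≤N with N ∸ k in N∸k≡
  ... | zero  = fr-nonneg (k + x) N
  ... | suc q = subst (λ N → fr x (suc q) ≤ℚ fr (k + x) N) (sym N≡) (fr-cross-≤ x q (k + x) (k + q) cross)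
    where
    N≡ : N ≡ suc (k + q)
    N≡ = trans (sym (ℕP.m+[n∸m]≡n (ℕP.≤-trans (ℕP.m≤m+n k x) k+x≤N))) (trans (cong (λ y → k + y) N∸k≡) (ℕP.+-suc k q))
    x≤sq : x ≤ suc q
    x≤sq = ℕP.+-cancelˡ-≤ k x (suc q) (subst (k + x ≤_) (trans N≡ (sym (ℕP.+-suc k q))) k+x≤N)
    cross : x * suc (k + q) ≤ (k + x) * suc q
    cross = begin
      x * suc (k + q)         ≡⟨ cong (x *_) (sym (ℕP.+-suc k q)) ⟩
      x * (k + suc q)         ≡⟨ ℕP.*-distribˡ-+ x k (suc q) ⟩
      x * k + x * suc q       ≤⟨ ℕP.+-monoˡ-≤ (x * suc q) (ℕP.*-monoˡ-≤ k x≤sq) ⟩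
      suc q * k + x * suc q   ≡⟨ cong (_+ x * suc q) (ℕP.*-comm (suc q) k) ⟩
      k * suc q + x * suc q   ≡⟨ ℕP.*-distribʳ-+ (suc q) k x ⟨
      (k + x) * suc q         ∎
      where open ℕP.≤-Reasoning

module Budget (T : Tree) (P : Partition T) (D : ℕ) (t : Tour T) (length≤D : tourLength T t ≤ D) where
  open Tree T
  open Partition P
  open Ancestry T
  open Traversal T t
  open Components T P
  open Fraction T P
  open ℕ∑
  open import Data.Nat using (_+_; _*_; _∸_)
  open import Algebra.Properties.Semiring.Sum ℕP.+-*-semiring using (*-distribˡ-sum)
  module ℕD = Decomposition T P ℕP.+-0-commutativeMonoid
  module ℚD = Decomposition T P ℚP.+-0-commutativeMonoid

  cost : Fin n → ℕ
  cost e = w e * traversals e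

  compLength : Fin m → ℕ
  compLength c = ∑[ e < n ] when (does (comp e Fin.≟ c)) (cost e)

  subLength≡compLength : ∀ c → subLength T P t c ≡ compLength c
  subLength≡compLength c = foldr-map-allFin (λ e → when (does (comp e Fin.≟ c)) (cost e))

  ∑-over-comps : (b : Fin m → Bool) → ∑[ c < m ] when (b c) (compLength c) ≡ ∑[ e < n ] when (b (comp e)) (cost e)
  ∑-over-comps b = begin
    ∑[ c < m ] when (b c) (compLength c)
      ≡⟨ sum-cong-≗ (λ c → when-sum (b c) (λ e → when (does (comp e Fin.≟ c)) (cost e))) ⟩
    ∑[ c < m ] ∑[ e < n ] when (b c) (when (does (comp e Fin.≟ c)) (cost e))
      ≡⟨ ∑-comm (λ c e → when (b c) (when (does (comp e Fin.≟ c)) (cost e))) ⟩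
    ∑[ e < n ] ∑[ c < m ] when (b c) (when (does (comp e Fin.≟ c)) (cost e))
      ≡⟨ sum-cong-≗ (λ e → sum-single (comp e) _ λ c c≢ce →
           trans (cong (when (b c)) (when-no (comp e Fin.≟ c) (cost e) (c≢ce ∘ sym))) (when-0 (b c))) ⟩
    ∑[ e < n ] when (b (comp e)) (when (does (comp e Fin.≟ comp e)) (cost e))
      ≡⟨ sum-cong-≗ (λ e → cong (when (b (comp e))) (when-yes (comp e Fin.≟ comp e) (cost e) refl)) ⟩
    ∑[ e < n ] when (b (comp e)) (cost e) ∎
    where open ≡-Reasoning

  lengthBelow : Vertex T → ℕ
  lengthBelow = ℕD.sumBelow compLength

  lengthBelow≡∑cost : ∀ v → lengthBelow v ≡ ∑[ e < n ] when (does (v ⊑? rt (comp e))) (cost e)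
  lengthBelow≡∑cost v = ∑-over-comps (λ c → does (v ⊑? rt c))

  lengthBelow-root : lengthBelow (root T) ≡ tourLength T t
  lengthBelow-root = trans (lengthBelow≡∑cost (root T)) (trans
    (sum-cong-≗ (λ e → when-yes (root T ⊑? rt (comp e)) (cost e) (root-⊑ _)))
    (sym (foldr-map-allFin cost)))

  exit-on-subtour⇔ : ∀ c x k → ex c ≡ just x → x ≡ suc k → comp k ≡ c
                   → Data.Bool.T (onSub T P t c x) ⇔ 0 < traversals k
  exit-on-subtour⇔ c x k ex≡ x≡sk ck≡c = mk⇔ to from
    where
    touches : Fin n → Bool
    touches e = does (comp e Fin.≟ c) ∧ (0 <ᵇ traversals e) ∧ (does (x Fin.≟ suc e) ∨ does (x Fin.≟ parent e))
    to : Data.Bool.T (onSub T P t c x) → 0 < traversals k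
    to on with Equivalence.to (T-∨ {does (x Fin.≟ rt c)}) on
    ... | inj₁ x≡rc = ⊥-elim (IsExit.exit≢root (isExit c x ex≡) (T-does⇒ (x Fin.≟ rt c) x≡rc))
    ... | inj₂ some with satisfied (any⁻ touches (allFin n) some)
    ...   | j , tj with Equivalence.to (T-∧ {does (comp j Fin.≟ c)}) tj
    ...     | _ , rest with Equivalence.to (T-∧ {0 <ᵇ traversals j}) rest
    ...       | 0<τj , x-end with Equivalence.to (T-∨ {does (x Fin.≟ suc j)}) x-end
    ...         | inj₁ x≡sj with suc-injective (trans (sym x≡sk) (T-does⇒ (x Fin.≟ suc j) x≡sj))
    ...           | refl = ℕP.<ᵇ⇒< 0 (traversals j) 0<τj
    to on | inj₂ some | j , tj | _ , rest | 0<τj , x-end | inj₂ x≡pj =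
      traversed-upward-closed j k (ℕP.<ᵇ⇒< 0 (traversals j) 0<τj)
        (≼-step (subst (_⊑ parent j) x≡sk (subst (x ⊑_) (T-does⇒ (x Fin.≟ parent j) x≡pj) ≼-refl)))
    from : 0 < traversals k → Data.Bool.T (onSub T P t c x)
    from 0<τk = Equivalence.from (T-∨ {does (x Fin.≟ rt c)}) (inj₂ (any⁺ touches (Any.map (λ { refl → tk }) (∈-allFin k))))
      where
      true⇒T : ∀ {b} → b ≡ true → Data.Bool.T b
      true⇒T = Equivalence.from T-≡
      tk : Data.Bool.T (touches k)
      tk = Equivalence.from (T-∧ {does (comp k Fin.≟ c)}) (true⇒T (dec-true (comp k Fin.≟ c) ck≡c) ,
             Equivalence.from (T-∧ {0 <ᵇ traversals k}) (ℕP.<⇒<ᵇ 0<τk ,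
               Equivalence.from (T-∨ {does (x Fin.≟ suc k)}) (inj₁ (true⇒T (dec-true (x Fin.≟ suc k) x≡sk)))))

  room : Vertex T → ℕ
  room v = D ∸ 2 * depth T v

  budget : Vertex T → ℚ
  budget v = fr (lengthBelow v) (room v)

  budgetExit : Maybe (Vertex T) → ℚ
  budgetExit nothing  = 0ℚ
  budgetExit (just x) = budget x

  reduced : Fin m → ℚ
  reduced = reducedLength T P D t

  record Bounded (c : Fin m) : Set where
    field
      reduced-nonneg  : 0ℚ ≤ℚ reduced c
      reduced+budget≤ : reduced c ℚ.+ budgetExit (ex c) ≤ℚ fr (compLength c + ℕD.sumBelowExit compLength (ex c)) (room (rt c))

  reduced-leaf : ∀ c → ex c ≡ nothing → reduced c ≡ endingRL T P D t c
  reduced-leaf c ex≡ with ex c | ex≡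
  ... | nothing | refl = refl

  reduced-internal : ∀ c x → ex c ≡ just x
                   → reduced c ≡ (if onSub T P t c x then passingRL T P D t c x else endingRL T P D t c)
  reduced-internal c x ex≡ with ex c | ex≡
  ... | just _ | refl = refl

  ending-bounded : ∀ c → reduced c ≡ endingRL T P D t c → ℕD.sumBelowExit compLength (ex c) ≡ 0 → Bounded c
  ending-bounded c reduced≡ below≡0 = record
    { reduced-nonneg  = subst (0ℚ ≤ℚ_) (sym reduced≡fr) (fr-nonneg (compLength c) (room (rt c)))
    ; reduced+budget≤ = ℚP.≤-reflexive (begin
        reduced c ℚ.+ budgetExit (ex c)        ≡⟨ cong₂ ℚ._+_ reduced≡fr (budgetExit≡0 (ex c) below≡0) ⟩
        fr (compLength c) (room (rt c)) ℚ.+ 0ℚ ≡⟨ ℚP.+-identityʳ _ ⟩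
        fr (compLength c) (room (rt c))        ≡⟨ cong (λ L → fr L (room (rt c))) (ℕP.+-identityʳ (compLength c)) ⟨
        fr (compLength c + 0) (room (rt c))    ≡⟨ cong (λ L → fr (compLength c + L) (room (rt c))) below≡0 ⟨
        fr (compLength c + ℕD.sumBelowExit compLength (ex c)) (room (rt c)) ∎) }
    where
    open ≡-Reasoning
    reduced≡fr : reduced c ≡ fr (compLength c) (room (rt c))
    reduced≡fr = trans reduced≡ (cong (λ L → fr L (room (rt c))) (subLength≡compLength c))
    budgetExit≡0 : ∀ mx → ℕD.sumBelowExit compLength mx ≡ 0 → budgetExit mx ≡ 0ℚ
    budgetExit≡0 nothing  _       = refl
    budgetExit≡0 (just x) below≡0 = trans (cong (λ L → fr L (room x)) below≡0) (fr-zero (room x))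

  lengthBelow-untraversed : ∀ x k → x ≡ suc k → ¬ 0 < traversals k → lengthBelow x ≡ 0
  lengthBelow-untraversed x k x≡sk ¬0<τk = trans (lengthBelow≡∑cost x) (sum-zero _ cost≡0)
    where
    cost≡0 : ∀ e → when (does (x ⊑? rt (comp e))) (cost e) ≡ 0
    cost≡0 e with x ⊑? rt (comp e)
    ... | no _     = refl
    ... | yes x⊑rce with traversals≡0⊎2 e
    ...   | inj₁ τe≡0 = trans (cong (w e *_) τe≡0) (ℕP.*-zeroʳ (w e))
    ...   | inj₂ τe≡2 = ⊥-elim (¬0<τk (traversed-upward-closed e k (subst (0 <_) (sym τe≡2) (s≤s z≤n))
                          (subst (_⊑ suc e) x≡sk (⊑-trans x⊑rce (⊑-trans (rt⊑parent e) (≼-step ≼-refl))))))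

  module Passing (c : Fin m) (x : Vertex T) (ex≡ : ex c ≡ just x) (on : Data.Bool.T (onSub T P t c x)) where
    open IsExit (isExit c x ex≡)

    v : Vertex T
    v = rt c

    v⊑x : v ⊑ x
    v⊑x = rt⊑exit c x ex≡

    δ : ℕ
    δ = pathWeight v x

    traversed-twice-above : ∀ e → suc e ⊑ x → traversals e ≡ 2
    traversed-twice-above e se⊑x with exit-edge c x ex≡
    ... | k , x≡sk , ck≡c , _ = traversed⇒≡2 e (traversed-upward-closed k e
           (Equivalence.to (exit-on-subtour⇔ c x k ex≡ x≡sk ck≡c) on) (subst (suc e ⊑_) x≡sk se⊑x))

    cost-above : ∀ e → suc e ⊑ x → 2 * w e ≡ cost e
    cost-above e se⊑x = trans (ℕP.*-comm 2 (w e)) (cong (w e *_) (sym (traversed-twice-above e se⊑x)))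

    twice-pathWeight≤ : 2 * δ ≤ compLength c
    twice-pathWeight≤ = ℕP.≤-trans (ℕP.≤-reflexive (*-distribˡ-sum 2 λ e → when (does (suc e ⊑? x ×-dec ¬? (suc e ⊑? v))) (w e)))
                          (ℕ∑≤.sum-mono λ e → on-path e (suc e ⊑? v) (suc e ⊑? x) (comp e Fin.≟ c))
      where
      on-path : ∀ e (above-v : Dec (suc e ⊑ v)) (above-x : Dec (suc e ⊑ x)) (in-c : Dec (comp e ≡ c))
              → 2 * when (does (above-x ×-dec ¬? above-v)) (w e) ≤ when (does in-c) (cost e)
      on-path e _          (no _)        _         = z≤n
      on-path e (yes _)    (yes _)       _         = z≤n
      on-path e (no _)     (yes se⊑x)    (yes _)   = ℕP.≤-reflexive (cost-above e se⊑x)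
      on-path e (no se⋢v)  (yes se⊑x)    (no ce≢c) = ⊥-elim (ce≢c (comp-on-path c x e exit∈comp v⊑pe se⊑x))
        where
        v⊑pe : v ⊑ parent e
        v⊑pe with ⊑-total-below v⊑x se⊑x
        ... | inj₂ se⊑v = ⊥-elim (se⋢v se⊑v)
        ... | inj₁ v⊑se with ⊑suc-inv v⊑se
        ...   | inj₁ v≡se = ⊥-elim (se⋢v (subst (suc e ⊑_) (sym v≡se) ≼-refl))
        ...   | inj₂ v⊑pe = v⊑pe

    -- Reaching r_c costs each edge above it twice; those edges, the edges of c and the edges below e_c are
    -- pairwise disjoint.
    disjoint-costs : 2 * depth T v + (compLength c + lengthBelow x) ≤ D
    disjoint-costs = begin
      2 * depth T v + (compLength c + lengthBelow x)
        ≡⟨ cong₂ _+_ (trans (cong (2 *_) (depth≡∑-above v)) (*-distribˡ-sum 2 λ e → when (does (suc e ⊑? v)) (w e)))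
                     (trans (cong (compLength c +_) (lengthBelow≡∑cost x)) (sym (∑-distrib-+ (λ e → when (does (comp e Fin.≟ c)) (cost e)) _))) ⟩
      ∑[ e < n ] (2 * when (does (suc e ⊑? v)) (w e)) + ∑[ e < n ] (when (does (comp e Fin.≟ c)) (cost e) + when (does (x ⊑? rt (comp e))) (cost e))
        ≡⟨ ∑-distrib-+ (λ e → 2 * when (does (suc e ⊑? v)) (w e)) _ ⟨
      ∑[ e < n ] (2 * when (does (suc e ⊑? v)) (w e) + (when (does (comp e Fin.≟ c)) (cost e) + when (does (x ⊑? rt (comp e))) (cost e)))
        ≤⟨ ℕ∑≤.sum-mono (λ e → at-most-once e (suc e ⊑? v) (comp e Fin.≟ c) (x ⊑? rt (comp e))) ⟩
      ∑[ e < n ] cost e  ≡⟨ foldr-map-allFin cost ⟨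
      tourLength T t     ≤⟨ length≤D ⟩
      D ∎
      where
      open ℕP.≤-Reasoning
      at-most-once : ∀ e (above-v : Dec (suc e ⊑ v)) (in-c : Dec (comp e ≡ c)) (below-x : Dec (x ⊑ rt (comp e)))
                   → 2 * when (does above-v) (w e) + (when (does in-c) (cost e) + when (does below-x) (cost e)) ≤ cost e
      at-most-once e (yes se⊑v) (yes ce≡c) _ = ⊥-elim (suc⊑⇒⋢parent se⊑v (subst (λ c → rt c ⊑ parent e) ce≡c (rt⊑parent e)))
      at-most-once e (yes se⊑v) (no _) (yes x⊑rce) = ⊥-elim (suc⊑⇒⋢parent (⊑-trans se⊑v v⊑x) (⊑-trans x⊑rce (rt⊑parent e)))
      at-most-once e (yes se⊑v) (no _) (no _) = ℕP.≤-reflexive (trans (ℕP.+-identityʳ _) (cost-above e (⊑-trans se⊑v v⊑x)))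
      at-most-once e (no _) (yes ce≡c) (yes x⊑rce) = ⊥-elim (exit≢root (⊑-antisym (subst (λ c → x ⊑ rt c) ce≡c x⊑rce) v⊑x))
      at-most-once e (no _) (yes _) (no _) = ℕP.≤-reflexive (ℕP.+-identityʳ (cost e))
      at-most-once e (no _) (no _) below-x = ℕ∑≤.when≤ (does below-x) z≤n

    offPath : ℕ
    offPath = compLength c ∸ 2 * δ

    2δ+offPath≡compLength : 2 * δ + offPath ≡ compLength c
    2δ+offPath≡compLength = ℕP.m+[n∸m]≡n twice-pathWeight≤

    room-exit : room x ≡ room v ∸ 2 * δ
    room-exit = begin
      D ∸ 2 * depth T x               ≡⟨ cong (λ d → D ∸ 2 * d) (depth-via v⊑x) ⟩
      D ∸ 2 * (depth T v + δ)         ≡⟨ cong (D ∸_) (ℕP.*-distribˡ-+ 2 (depth T v) δ) ⟩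
      D ∸ (2 * depth T v + 2 * δ)     ≡⟨ ℕP.∸-+-assoc D (2 * depth T v) (2 * δ) ⟨
      D ∸ 2 * depth T v ∸ 2 * δ       ∎
      where open ≡-Reasoning

    reduced≡ : reduced c ≡ fr offPath (room x)
    reduced≡ = begin
      reduced c
        ≡⟨ reduced-internal c x ex≡ ⟩
      (if onSub T P t c x then passingRL T P D t c x else endingRL T P D t c)
        ≡⟨ cong (λ b → if b then passingRL T P D t c x else endingRL T P D t c) (Equivalence.to T-≡ on) ⟩
      frac T P (ℤ.+ subLength T P t c ℤ.- ℤ.+ (2 * (depth T x ∸ depth T v))) (room x)
        ≡⟨ cong₂ (λ L d → frac T P (ℤ.+ L ℤ.- ℤ.+ (2 * d)) (room x)) (subLength≡compLength c)
                 (trans (cong (_∸ depth T v) (depth-via v⊑x)) (ℕP.m+n∸m≡n (depth T v) δ)) ⟩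
      frac T P (ℤ.+ compLength c ℤ.- ℤ.+ (2 * δ)) (room x)
        ≡⟨ cong (λ z → frac T P z (room x)) (trans (ℤP.m-n≡m⊖n (compLength c) (2 * δ)) (ℤP.⊖-≥ twice-pathWeight≤)) ⟩
      fr offPath (room x) ∎
      where open ≡-Reasoning

    fits : 2 * δ + (offPath + lengthBelow x) ≤ room v
    fits = subst (_≤ room v) (trans (cong (_+ lengthBelow x) (sym 2δ+offPath≡compLength)) (ℕP.+-assoc (2 * δ) offPath (lengthBelow x)))
             (ℕP.m+n≤o⇒m≤o∸n (compLength c + lengthBelow x)
               (subst (_≤ D) (ℕP.+-comm (2 * depth T v) _) disjoint-costs))

    bounded : Bounded c
    bounded = record
      { reduced-nonneg  = subst (0ℚ ≤ℚ_) (sym reduced≡) (fr-nonneg offPath (room x))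
      ; reduced+budget≤ = begin
          reduced c ℚ.+ budgetExit (ex c)
            ≡⟨ cong₂ ℚ._+_ reduced≡ (cong budgetExit ex≡) ⟩
          fr offPath (room x) ℚ.+ fr (lengthBelow x) (room x)
            ≡⟨ fr-+ (room x) offPath (lengthBelow x) ⟨
          fr (offPath + lengthBelow x) (room x)
            ≡⟨ cong (fr (offPath + lengthBelow x)) room-exit ⟩
          fr (offPath + lengthBelow x) (room v ∸ 2 * δ)
            ≤⟨ fr-shift-≤ (2 * δ) (offPath + lengthBelow x) (room v) fits ⟩
          fr (2 * δ + (offPath + lengthBelow x)) (room v)
            ≡⟨ cong (λ L → fr L (room v)) (ℕP.+-assoc (2 * δ) offPath (lengthBelow x)) ⟨
          fr (2 * δ + offPath + lengthBelow x) (room v)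
            ≡⟨ cong₂ (λ L L′ → fr (L + L′) (room v)) 2δ+offPath≡compLength (cong (ℕD.sumBelowExit compLength) (sym ex≡)) ⟩
          fr (compLength c + ℕD.sumBelowExit compLength (ex c)) (room v) ∎ }
      where open ℚP.≤-Reasoning

  unreached-exit : ∀ c x → ex c ≡ just x → onSub T P t c x ≡ false → lengthBelow x ≡ 0
  unreached-exit c x ex≡ off with exit-edge c x ex≡
  ... | k , x≡sk , ck≡c , _ = lengthBelow-untraversed x k x≡sk λ 0<τk →
    subst Data.Bool.T off (Equivalence.from (exit-on-subtour⇔ c x k ex≡ x≡sk ck≡c) 0<τk)

  bounded : ∀ c → Bounded c
  bounded c with ex c in ex≡
  ... | nothing = ending-bounded c (reduced-leaf c ex≡) (cong (ℕD.sumBelowExit compLength) ex≡)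
  ... | just x with onSub T P t c x in on≡
  ...   | true  = Passing.bounded c x ex≡ (Equivalence.from T-≡ on≡)
  ...   | false = ending-bounded c
          (trans (reduced-internal c x ex≡) (cong (λ b → if b then passingRL T P D t c x else endingRL T P D t c) on≡))
          (trans (cong (ℕD.sumBelowExit compLength) ex≡) (unreached-exit c x ex≡ on≡))

  reducedBelow : Vertex T → ℚ
  reducedBelow = ℚD.sumBelow reduced

  reducedBelow≤budget : ∀ v → Hub v → reducedBelow v ≤ℚ budget v
  reducedBelow≤budget v = go (suc n) v (ℕP.m≤n⇒m≤o+n (toℕ v) ℕP.≤-refl)
    where
    go : ∀ k v → n < toℕ v + k → Hub v → reducedBelow v ≤ℚ budget v
    go zero    v n<v+0 _   = ⊥-elim (ℕP.<⇒≱ (subst (n <_) (ℕP.+-identityʳ (toℕ v)) n<v+0) (ℕP.≤-pred (toℕ<n v)))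
    go (suc k) v n<v+k hub = begin
      reducedBelow v
        ≡⟨ ℚD.sumBelow-hub reduced v hub ⟩
      ℚ∑.sum (λ c → at-v c (reduced c ℚ.+ ℚD.sumBelowExit reduced (ex c)))
        ≤⟨ ℚ∑≤.sum-mono (λ c → exits-within c (rt c Fin.≟ v) (ex c) refl) ⟩
      ℚ∑.sum (λ c → at-v c (reduced c ℚ.+ budgetExit (ex c)))
        ≤⟨ ℚ∑≤.sum-mono (λ c → ℚ∑≤.when-mono (does (rt c Fin.≟ v)) (Bounded.reduced+budget≤ (bounded c))) ⟩
      ℚ∑.sum (λ c → at-v c (fr (compLength c + ℕD.sumBelowExit compLength (ex c)) (room (rt c))))
        ≡⟨ ℚ∑.sum-cong-≗ (λ c → room-at-v c (rt c Fin.≟ v)) ⟩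
      ℚ∑.sum (λ c → at-v c (fr (compLength c + ℕD.sumBelowExit compLength (ex c)) (room v)))
        ≡⟨ fr-sum-when (room v) (λ c → does (rt c Fin.≟ v)) (λ c → compLength c + ℕD.sumBelowExit compLength (ex c)) ⟨
      fr (∑[ c < m ] when (does (rt c Fin.≟ v)) (compLength c + ℕD.sumBelowExit compLength (ex c))) (room v)
        ≡⟨ cong (λ L → fr L (room v)) (ℕD.sumBelow-hub compLength v hub) ⟨
      budget v ∎
      where
      open ℚP.≤-Reasoning
      at-v : Fin m → ℚ → ℚ
      at-v c = ℚ∑.when (does (rt c Fin.≟ v))
      exits-within : ∀ c (rc≟v : Dec (rt c ≡ v)) mx → ex c ≡ mx
                   → ℚ∑.when (does rc≟v) (reduced c ℚ.+ ℚD.sumBelowExit reduced mx) ≤ℚ ℚ∑.when (does rc≟v) (reduced c ℚ.+ budgetExit mx)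
      exits-within c (no _)     _        _   = ℚP.≤-refl
      exits-within c (yes _)    nothing  _   = ℚP.≤-refl
      exits-within c (yes rc≡v) (just x) ex≡ = ℚP.+-monoʳ-≤ (reduced c) (go k x n<x+k (inj₂ (c , ex≡)))
        where
        n<x+k : n < toℕ x + k
        n<x+k = ℕP.<-≤-trans n<v+k (subst (_≤ toℕ x + k) (sym (ℕP.+-suc (toℕ v) k))
                  (ℕP.+-monoˡ-≤ k (subst (λ u → toℕ u < toℕ x) rc≡v (rt⊏exit c x ex≡))))
      room-at-v : ∀ c (rc≟v : Dec (rt c ≡ v)) → ∀ {L}
                → ℚ∑.when (does rc≟v) (fr L (room (rt c))) ≡ ℚ∑.when (does rc≟v) (fr L (room v))
      room-at-v c (no _)     = refl
      room-at-v c (yes rc≡v) = cong (λ u → fr _ (room u)) rc≡v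

lemma11 : (T : Tree) (P : Partition T) (U : Vertex T → Set) (D : ℕ) → 0 < D
    → (t : Tour T) → tourLength T t ≤ D
    → (cs : List (Fin (Partition.m P))) → Unique cs
    → (∀ c → c ∈ cs → VisitedComp T P U t c)
    → (∀ c → VisitedComp T P U t c → c ∈ cs)
    → All (DenomPos T P D t) cs
    → sumℚ (map (reducedLength T P D t) cs) ≤ℚ 1ℚ
lemma11 T P U D 0<D t length≤D cs unique _ _ _ = begin
  sumℚ (map reduced cs)                               ≡⟨ ℚ∑.foldr-map-unique reduced cs unique ⟩
  ℚ∑.sum (λ c → ℚ∑.when (does (c ∈? cs)) (reduced c)) ≤⟨ ℚ∑≤.sum-mono (λ c → ℚ∑≤.when≤ _ (Bounded.reduced-nonneg (bounded c))) ⟩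
  ℚ∑.sum reduced                                      ≡⟨ ℚ∑.sum-cong-≗ (λ c → ℚ∑.when-yes (root T ⊑? rt c) (reduced c) (root-⊑ (rt c))) ⟨
  reducedBelow (root T)                               ≤⟨ reducedBelow≤budget (root T) (inj₁ refl) ⟩
  budget (root T)                                     ≤⟨ fr≤1 _ D (subst (_≤ D) (sym lengthBelow-root) length≤D) 0<D ⟩
  1ℚ                                                  ∎
  where
  open Partition P
  open Ancestry T
  open Fraction T P
  open Budget T P D t length≤D
  open Data.List.Membership.DecPropositional (Fin._≟_ {m}) using (_∈?_)
  open ℚP.≤-Reasoning
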